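{- Let $U = \langle \iota \mapsto I_\iota\rangle^{\iota \in [1..n]}$ be a program, $\sigma$ and $\tau$ finite configurations, $\sigma_{\infty}$ and $\tau_{\infty}$ infinite configurations, and let $h \in [1..n]$. Then the following properties hold: (1) $cp_+(U,\sigma,h,\tau) \land \sigma \models U \land \sigma \subset \sigma_{\infty} \land \tau \subset \tau_{\infty} \Rightarrow cp_+(U,\sigma_{\infty},h,\tau_{\infty})$; (2) $cp_{\infty}(U,\sigma,h) \land \sigma \models U \land \sigma \subset \sigma_{\infty} \Rightarrow cp_{\infty}(U,\sigma_{\infty},h)$; (3) $cp_+(U,\sigma_{\infty},h,\tau_{\infty}) \Rightarrow cp_+(U,\sigma_{\infty | U},h,\tau_{\infty | U})$; (4) $cp_{\infty}(U,\sigma_{\infty},h) \Rightarrow cp_{\infty}(U,\sigma_{\infty | U},h)$.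
   Context: Setting: the Unlimited Register Machine (URM, Cutland's formulation) formalized in the Calculus of (Co)Inductive Constructions ($\text{CC}^\text{(Co)Ind}$). Instructions: $Z(i)$ ($0 \to R_i$), $S(i)$ ($r_i+1 \to R_i$), $T(i,j)$ ($r_i \to R_j$), $J(i,j,k)$ (if $r_i = r_j$ proceed from the $k$th instruction, else from the next). A program $U = \langle \iota \mapsto I_\iota\rangle^{\iota \in [1..n]}$ is in standard form if every $J(i,j,k) \in U$ has $k \leq n$ (jump target $0$ means halting). A finite (list) configuration is $\sigma = (\iota \mapsto s_\iota)^{\iota \in [1..m]}$; an infinite (stream) configuration is $\tau_{\infty} = (\iota \mapsto t_\iota)^{\iota \in [1..\infty)}$. Compatibility $\sigma \models U$: $U$ is in standard form and for every $Z(i), S(i), T(i,j), J(i,j,k) \in U$, $i,j \in [1..m]$. Inclusion: $\sigma \subset \tau_{\infty}$ iff $t_\iota = s_\iota$ for all $\iota \in [1..m]$ and $t_\iota = 0$ for all $\iota > m$. Restriction: $\tau_{\infty | U} = (\iota \mapsto t_\iota)^{\iota \in [1..\rho(U)]}$, where $\rho(U)$ is the maximal register index affected by the instructions of $U$. Evaluation (for $h \in [1..n]$, $r_i$ the content of $R_i$ in the current configuration): $cp_+(U,\sigma,h,\tau)$ (computation from the $h$th instruction stops, turning $\sigma$ into $\tau$) is defined inductively by: if $I_h = J(i,j,k)$: ($h = n$, $r_i \neq r_j$) gives $cp_+(U,\sigma,h,\sigma)$; ($h<n$, $r_i \neq r_j$, $cp_+(U,\sigma,h+1,\tau)$) gives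 $cp_+(U,\sigma,h,\tau)$; ($k=0$, $r_i = r_j$) gives $cp_+(U,\sigma,h,\sigma)$; ($k \neq 0$, $r_i = r_j$, $cp_+(U,\sigma,k,\tau)$) gives $cp_+(U,\sigma,h,\tau)$. If $I_h$ is $Z(i)$, $S(i)$ or $T(i,j)$, let $f(\sigma)$ be respectively $zr(\sigma,i)$ (set $R_i$ to $0$), $sc(\sigma,i)$ (increment $R_i$), $mv(\sigma,i,j)$ (copy $r_i$ into $R_j$): ($h=n$) gives $cp_+(U,\sigma,h,f(\sigma))$; ($h<n$, $cp_+(U,f(\sigma),h+1,\tau)$) gives $cp_+(U,\sigma,h,\tau)$. $cp_{\infty}(U,\sigma,h)$ (computation from the $h$th instruction diverges) is defined coinductively by: for $I_h = J(i,j,k)$: ($h<n$, $r_i \neq r_j$, $cp_{\infty}(U,\sigma,h+1)$) gives $cp_{\infty}(U,\sigma,h)$; ($k\neq 0$, $r_i = r_j$, $cp_{\infty}(U,\sigma,k)$) gives $cp_{\infty}(U,\sigma,h)$; for $Z$, $S$, $T$: ($h<n$, $cp_{\infty}(U,f(\sigma),h+1)$) gives $cp_{\infty}(U,\sigma,h)$. These rules are given for infinite configurations; $cp_+$ and $cp_\infty$ are overloaded with a second definition on finite configurations using the same rules plus the extra compatibility constraint between the finite configuration and the program.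
   Formalization: Parts (3) and (4) hold only for U in standard form (every J(i,j,k) ∈ U has k ≤ n), and ρ(U) is the maximal register index occurring anywhere in U, read registers of T and J included. The paper assumes this as well. -}

module Defs where

open import Data.Nat using (ℕ; zero; suc; _≤_; _<_; _>_; _⊔_; _≟_)
open import Data.List using (List; []; _∷_; length; applyUpTo)
open import Data.List.Relation.Unary.All using (All)
open import Data.Maybe using (Maybe; just; nothing)
open import Data.Product using (Σ; _×_)
open import Data.Unit using (⊤)
open import Relation.Binary.PropositionalEquality using (_≡_; _≢_)
open import Relation.Nullary using (yes; no)

record Reg : Set where
  constructor reg
  field
    idx : ℕ
    pos : 1 ≤ idx
open Reg public

-- URM instructions (Cutland): Z(i), S(i), T(i,j), J(i,j,k).
-- The jump target k is a natural number, k = 0 meaning "halt".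
data Instr : Set where
  Z : Reg → Instr
  S : Reg → Instr
  T : Reg → Reg → Instr
  J : Reg → Reg → ℕ → Instr

Program : Set
Program = List Instr

-- I_h, 1-based (nothing if h = 0 or h > n).
instrAt : Program → ℕ → Maybe Instr
instrAt []       _             = nothing
instrAt (I ∷ U)  zero          = nothing
instrAt (I ∷ U)  (suc zero)    = just I
instrAt (I ∷ U)  (suc (suc h)) = instrAt U (suc h)

RegsBounded : ℕ → Instr → Set
RegsBounded m (Z i)     = idx i ≤ m
RegsBounded m (S i)     = idx i ≤ m
RegsBounded m (T i j)   = idx i ≤ m × idx j ≤ m
RegsBounded m (J i j k) = idx i ≤ m × idx j ≤ m

JumpBounded : ℕ → Instr → Set
JumpBounded n (J i j k) = k ≤ n
JumpBounded n _         = ⊤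

StandardForm : Program → Set
StandardForm U = All (JumpBounded (length U)) U

ρI : Instr → ℕ
ρI (Z i)     = idx i
ρI (S i)     = idx i
ρI (T i j)   = idx i ⊔ idx j
ρI (J i j k) = idx i ⊔ idx j

ρ : Program → ℕ
ρ []      = 0
ρ (I ∷ U) = ρI I ⊔ ρ U

Config : Set
Config = List ℕ

-- s_ι (1-based; 0 outside [1..m], never used under compatibility).
getF : Config → ℕ → ℕ
getF []      _             = 0
getF (s ∷ σ) zero          = 0
getF (s ∷ σ) (suc zero)    = s
getF (s ∷ σ) (suc (suc ι)) = getF σ (suc ι)

-- replace s_ι by v (1-based; unchanged outside [1..m]).
setF : Config → ℕ → ℕ → Config
setF []      _             v = []
setF (s ∷ σ) zero          v = s ∷ σ
setF (s ∷ σ) (suc zero)    v = v ∷ σ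
setF (s ∷ σ) (suc (suc ι)) v = s ∷ setF σ (suc ι) v

-- Infinite configuration τ∞ = (ι ↦ t_ι)^{ι ∈ [1..∞)}, represented as a
-- function: t_ι = τ∞ ι for ι ≥ 1 (the value at 0 is irrelevant).
Config∞ : Set
Config∞ = ℕ → ℕ

getI : Config∞ → ℕ → ℕ
getI τ ι = τ ι

setI : Config∞ → ℕ → ℕ → Config∞
setI τ ι v κ with κ ≟ ι
... | yes _ = v
... | no  _ = τ κ

_≈∞_ : Config∞ → Config∞ → Set
τ ≈∞ τ' = ∀ ι → 1 ≤ ι → τ ι ≡ τ' ι

_⊨_ : Config → Program → Set
σ ⊨ U = StandardForm U × All (RegsBounded (length σ)) U

_⊂_ : Config → Config∞ → Set
σ ⊂ τ = (∀ ι → 1 ≤ ι → ι ≤ length σ → τ ι ≡ getF σ ι)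
      × (∀ ι → ι > length σ → τ ι ≡ 0)

restrict : Config∞ → Program → Config
restrict τ U = applyUpTo (λ ι → τ (suc ι)) (ρ U)

-- Evaluation, generic in the kind of configuration
--   C      : configurations
--   get    : r_i
--   set    : overwrite a register
--   _≈_    : equality of configurations (result of a halting step)
--   Ok     : extra side condition on each step (compatibility σ ⊨ U for
--            finite configurations, trivial for infinite ones)

module Eval (C : Set) (get : C → ℕ → ℕ) (set : C → ℕ → ℕ → C)
            (_≈_ : C → C → Set) (Ok : C → Program → Set) where

  zr : C → Reg → C
  zr σ i = set σ (idx i) 0

  sc : C → Reg → C
  sc σ i = set σ (idx i) (suc (get σ (idx i)))

  mv : C → Reg → Reg → C
  mv σ i j = set σ (idx j) (get σ (idx i))

  data Op : Instr → C → C → Set where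
    opZ : ∀ {σ i}   → Op (Z i)   σ (zr σ i)
    opS : ∀ {σ i}   → Op (S i)   σ (sc σ i)
    opT : ∀ {σ i j} → Op (T i j) σ (mv σ i j)

  data cp₊ (U : Program) : C → ℕ → C → Set where
    j-last  : ∀ {σ h i j k τ} → Ok σ U → instrAt U h ≡ just (J i j k) →
              h ≡ length U → get σ (idx i) ≢ get σ (idx j) → τ ≈ σ →
              cp₊ U σ h τ
    j-next  : ∀ {σ h i j k τ} → Ok σ U → instrAt U h ≡ just (J i j k) →
              h < length U → get σ (idx i) ≢ get σ (idx j) →
              cp₊ U σ (suc h) τ → cp₊ U σ h τ
    j-halt  : ∀ {σ h i j k τ} → Ok σ U → instrAt U h ≡ just (J i j k) →
              k ≡ 0 → get σ (idx i) ≡ get σ (idx j) → τ ≈ σ →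
              cp₊ U σ h τ
    j-jump  : ∀ {σ h i j k τ} → Ok σ U → instrAt U h ≡ just (J i j k) →
              k ≢ 0 → get σ (idx i) ≡ get σ (idx j) →
              cp₊ U σ k τ → cp₊ U σ h τ
    op-last : ∀ {σ h I σ' τ} → Ok σ U → instrAt U h ≡ just I → Op I σ σ' →
              h ≡ length U → τ ≈ σ' → cp₊ U σ h τ
    op-next : ∀ {σ h I σ' τ} → Ok σ U → instrAt U h ≡ just I → Op I σ σ' →
              h < length U → cp₊ U σ' (suc h) τ → cp₊ U σ h τ

  -- one step of the rules for cp∞, relative to a predicate P
  -- (the rule functor whose greatest fixed point is cp∞)
  data Step∞ (U : Program) (P : C → ℕ → Set) : C → ℕ → Set where
    j-next  : ∀ {σ h i j k} → Ok σ U → instrAt U h ≡ just (J i j k) →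
              h < length U → get σ (idx i) ≢ get σ (idx j) →
              P σ (suc h) → Step∞ U P σ h
    j-jump  : ∀ {σ h i j k} → Ok σ U → instrAt U h ≡ just (J i j k) →
              k ≢ 0 → get σ (idx i) ≡ get σ (idx j) →
              P σ k → Step∞ U P σ h
    op-next : ∀ {σ h I σ'} → Ok σ U → instrAt U h ≡ just I → Op I σ σ' →
              h < length U → P σ' (suc h) → Step∞ U P σ h

  -- cp∞(U,σ,h): coinductive, i.e. the greatest fixed point of Step∞ U:
  -- (σ,h) lies in some predicate P that is closed under the rules.
  cp∞ : Program → C → ℕ → Set₁
  cp∞ U σ h = Σ (C → ℕ → Set) λ P →
                P σ h × (∀ σ' h' → P σ' h' → Step∞ U P σ' h')

module Inf = Eval Config∞ getI setI _≈∞_ (λ _ _ → ⊤)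
module Fin = Eval Config getF setF _≡_ _⊨_

cp₊∞ = Inf.cp₊
cp∞∞ = Inf.cp∞
cp₊F = Fin.cp₊
cp∞F = Fin.cp∞

-- A finite configuration σ ⊂ σ∞, and the restriction σ∞|U of an infinite one, agree with
-- the infinite configuration on every register a compatible program mentions, and each
-- instruction preserves this agreement.  So all four parts are instances of a single
-- simulation argument: induction on cp₊, and for cp∞ coinduction with the invariant
-- "simulated by some configuration of the source fixed point".
module Submission where

open import Defs
open import Data.Nat using (ℕ; zero; suc; _≤_; _<_; _>_; _≟_; z≤n; s≤s)
open import Data.Nat.Properties using (m≤m⊔n; m≤n⊔m; ≤-refl; ≤-trans; ≰⇒>; <⇒≢; <-≤-trans; suc-injective; _≤?_)
open import Data.List using (List; []; _∷_; length; applyUpTo)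
open import Data.List.Properties using (length-applyUpTo)
open import Data.List.Relation.Unary.All as All using (All; []; _∷_)
open import Data.List.Membership.Propositional using (_∈_)
open import Data.List.Relation.Unary.Any using (here; there)
open import Data.Maybe using (just)
open import Data.Product using (Σ; _×_; _,_; proj₁; proj₂)
open import Data.Unit using (⊤; tt)
open import Relation.Binary.PropositionalEquality using (_≡_; _≢_; refl; sym; trans; cong; cong₂; subst; subst₂)
open import Relation.Nullary using (Dec; yes; no)
open import Data.Empty using (⊥-elim)

instrAt⇒∈ : ∀ U {h I} → instrAt U h ≡ just I → I ∈ U
instrAt⇒∈ (I ∷ U) {suc zero}    refl = here refl
instrAt⇒∈ (_ ∷ U) {suc (suc h)} e    = there (instrAt⇒∈ U e)

RegsBounded-mono : ∀ {m m'} I → m ≤ m' → RegsBounded m I → RegsBounded m' I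
RegsBounded-mono (Z i)     le r       = ≤-trans r le
RegsBounded-mono (S i)     le r       = ≤-trans r le
RegsBounded-mono (T i j)   le (r , q) = ≤-trans r le , ≤-trans q le
RegsBounded-mono (J i j k) le (r , q) = ≤-trans r le , ≤-trans q le

RegsBounded-ρI : ∀ I → RegsBounded (ρI I) I
RegsBounded-ρI (Z i)     = ≤-refl
RegsBounded-ρI (S i)     = ≤-refl
RegsBounded-ρI (T i j)   = m≤m⊔n (idx i) (idx j) , m≤n⊔m (idx i) (idx j)
RegsBounded-ρI (J i j k) = m≤m⊔n (idx i) (idx j) , m≤n⊔m (idx i) (idx j)

All-RegsBounded-ρ : ∀ U → All (RegsBounded (ρ U)) U
All-RegsBounded-ρ []      = []
All-RegsBounded-ρ (I ∷ U) =
  RegsBounded-mono I (m≤m⊔n (ρI I) (ρ U)) (RegsBounded-ρI I) ∷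
  All.map (RegsBounded-mono _ (m≤n⊔m (ρI I) (ρ U))) (All-RegsBounded-ρ U)

length-setF : ∀ σ i v → length (setF σ i v) ≡ length σ
length-setF []      i             v = refl
length-setF (s ∷ σ) zero          v = refl
length-setF (s ∷ σ) (suc zero)    v = refl
length-setF (s ∷ σ) (suc (suc i)) v = cong suc (length-setF σ (suc i) v)

getF-setF-same : ∀ σ {i} v → 1 ≤ i → i ≤ length σ → getF (setF σ i v) i ≡ v
getF-setF-same (s ∷ σ) {suc zero}    v _ _        = refl
getF-setF-same (s ∷ σ) {suc (suc i)} v _ (s≤s le) = getF-setF-same σ v (s≤s z≤n) le

getF-setF-other : ∀ σ {i} v {ι} → ι ≢ i → getF (setF σ i v) ι ≡ getF σ ι
getF-setF-other []      {i}           v {ι}           ne = refl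
getF-setF-other (s ∷ σ) {zero}        v {ι}           ne = refl
getF-setF-other (s ∷ σ) {suc zero}    v {zero}        ne = refl
getF-setF-other (s ∷ σ) {suc zero}    v {suc zero}    ne = ⊥-elim (ne refl)
getF-setF-other (s ∷ σ) {suc zero}    v {suc (suc ι)} ne = refl
getF-setF-other (s ∷ σ) {suc (suc i)} v {zero}        ne = refl
getF-setF-other (s ∷ σ) {suc (suc i)} v {suc zero}    ne = refl
getF-setF-other (s ∷ σ) {suc (suc i)} v {suc (suc ι)} ne =
  getF-setF-other σ v (λ e → ne (cong suc e))

setI-same : ∀ τ i v → setI τ i v i ≡ v
setI-same τ i v with i ≟ i
... | yes _  = refl
... | no  ne = ⊥-elim (ne refl)

setI-other : ∀ τ {i} v {ι} → ι ≢ i → setI τ i v ι ≡ τ ι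
setI-other τ {i} v {ι} ne with ι ≟ i
... | yes e = ⊥-elim (ne e)
... | no  _ = refl

getF-setF≡setI : ∀ σ τ {i v w ι} → 1 ≤ i → i ≤ length σ → v ≡ w →
  (ι ≢ i → getF σ ι ≡ τ ι) → getF (setF σ i v) ι ≡ setI τ i w ι
getF-setF≡setI σ τ {i} {v} {w} {ι} p le v≡w agree = by-cases (ι ≟ i)
  where
  by-cases : Dec (ι ≡ i) → getF (setF σ i v) ι ≡ setI τ i w ι
  by-cases (yes refl) = trans (getF-setF-same σ v p le) (trans v≡w (sym (setI-same τ i w)))
  by-cases (no  ne)   = trans (getF-setF-other σ v ne) (trans (agree ne) (sym (setI-other τ w ne)))

getF-ext : ∀ (xs ys : List ℕ) → length xs ≡ length ys →
  (∀ ι → 1 ≤ ι → ι ≤ length xs → getF xs ι ≡ getF ys ι) → xs ≡ ys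
getF-ext []       []       _   _  = refl
getF-ext (x ∷ xs) (y ∷ ys) len eq =
  cong₂ _∷_ (eq 1 (s≤s z≤n) (s≤s z≤n))
    (getF-ext xs ys (suc-injective len) λ { (suc ι) _ le → eq (suc (suc ι)) (s≤s z≤n) (s≤s le) })

⊂-getF : ∀ {σ σ∞ ι} → σ ⊂ σ∞ → 1 ≤ ι → ι ≤ length σ → getF σ ι ≡ σ∞ ι
⊂-getF sub p le = sym (proj₁ sub _ p le)

⊂-unique : ∀ {σ τ τ'} → σ ⊂ τ → σ ⊂ τ' → τ ≈∞ τ'
⊂-unique {σ} sub sub' ι p with ι ≤? length σ
... | yes le = trans (proj₁ sub ι p le) (sym (proj₁ sub' ι p le))
... | no  gt = trans (proj₂ sub ι (≰⇒> gt)) (sym (proj₂ sub' ι (≰⇒> gt)))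

setF-⊂-setI : ∀ {σ σ∞ i v w} → σ ⊂ σ∞ → 1 ≤ i → i ≤ length σ → v ≡ w →
  setF σ i v ⊂ setI σ∞ i w
setF-⊂-setI {σ} {σ∞} {i} {v} {w} sub p le v≡w = inside , outside
  where
  inside : ∀ ι → 1 ≤ ι → ι ≤ length (setF σ i v) → setI σ∞ i w ι ≡ getF (setF σ i v) ι
  inside ι q le' = sym (getF-setF≡setI σ σ∞ p le v≡w
    (λ _ → ⊂-getF {σ} {σ∞} sub q (subst (ι ≤_) (length-setF σ i v) le')))
  outside : ∀ ι → ι > length (setF σ i v) → setI σ∞ i w ι ≡ 0
  outside ι gt = trans (setI-other σ∞ w (λ { refl → <⇒≢ (<-≤-trans gt′ le) refl }))
                       (proj₂ sub ι gt′)
    where gt′ = subst (_< ι) (length-setF σ i v) gt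

⊂-Op : ∀ {I σ σ' σ∞} → σ ⊂ σ∞ → RegsBounded (length σ) I → Fin.Op I σ σ' →
  Σ Config∞ λ σ∞' → Inf.Op I σ∞ σ∞' × σ' ⊂ σ∞'
⊂-Op {σ = σ} {σ∞ = σ∞} sub rb (Fin.opZ {i = i}) =
  _ , Inf.opZ , setF-⊂-setI {σ} {σ∞} sub (pos i) rb refl
⊂-Op {σ = σ} {σ∞ = σ∞} sub rb (Fin.opS {i = i}) =
  _ , Inf.opS , setF-⊂-setI {σ} {σ∞} sub (pos i) rb (cong suc (⊂-getF {σ} {σ∞} sub (pos i) rb))
⊂-Op {σ = σ} {σ∞ = σ∞} sub (ri , rj) (Fin.opT {i = i} {j = j}) =
  _ , Inf.opT , setF-⊂-setI {σ} {σ∞} sub (pos j) rj (⊂-getF {σ} {σ∞} sub (pos i) ri)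

-- restrict τ U is prefix (ρ U) τ by definition.
prefix : ℕ → Config∞ → Config
prefix n τ = applyUpTo (λ ι → τ (suc ι)) n

length-prefix : ∀ n τ → length (prefix n τ) ≡ n
length-prefix n τ = length-applyUpTo (λ ι → τ (suc ι)) n

getF-prefix : ∀ n τ {ι} → 1 ≤ ι → ι ≤ n → getF (prefix n τ) ι ≡ τ ι
getF-prefix (suc n) τ {suc zero}    _ _        = refl
getF-prefix (suc n) τ {suc (suc ι)} _ (s≤s le) = getF-prefix n (λ x → τ (suc x)) (s≤s z≤n) le

prefix-cong : ∀ n {τ τ'} → τ ≈∞ τ' → prefix n τ ≡ prefix n τ'
prefix-cong zero    eq = refl
prefix-cong (suc n) eq = cong₂ _∷_ (eq 1 (s≤s z≤n)) (prefix-cong n λ ι _ → eq (suc ι) (s≤s z≤n))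

setF-prefix : ∀ {n τ i v w} → 1 ≤ i → i ≤ n → v ≡ w → setF (prefix n τ) i v ≡ prefix n (setI τ i w)
setF-prefix {n} {τ} {i} {v} {w} p le v≡w =
  getF-ext _ _ (trans (length-setF (prefix n τ) i v) (trans (length-prefix n τ) (sym (length-prefix n (setI τ i w)))))
    λ ι q le' →
      let ι≤n = subst (ι ≤_) (trans (length-setF (prefix n τ) i v) (length-prefix n τ)) le' in
      trans (getF-setF≡setI (prefix n τ) τ p (subst (i ≤_) (sym (length-prefix n τ)) le) v≡w
               (λ _ → getF-prefix n τ q ι≤n))
            (sym (getF-prefix n (setI τ i w) q ι≤n))

prefix-Op : ∀ {n I τ τ'} → RegsBounded n I → Inf.Op I τ τ' →
  Σ Config λ σ' → Fin.Op I (prefix n τ) σ' × σ' ≡ prefix n τ'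
prefix-Op {n} {τ = τ} rb (Inf.opZ {i = i}) =
  _ , Fin.opZ , setF-prefix {n} {τ} (pos i) rb refl
prefix-Op {n} {τ = τ} rb (Inf.opS {i = i}) =
  _ , Fin.opS , setF-prefix {n} {τ} (pos i) rb (cong suc (getF-prefix n τ (pos i) rb))
prefix-Op {n} {τ = τ} (ri , rj) (Inf.opT {i = i} {j = j}) =
  _ , Fin.opT , setF-prefix {n} {τ} (pos j) rj (getF-prefix n τ (pos i) ri)

restrict-⊨ : ∀ {U} τ → StandardForm U → restrict τ U ⊨ U
restrict-⊨ {U} τ sf = sf , subst (λ m → All (RegsBounded m) U) (sym (length-prefix (ρ U) τ)) (All-RegsBounded-ρ U)

module Transfer
  {A : Set} {getA : A → ℕ → ℕ} {setA : A → ℕ → ℕ → A} {_≈A_ : A → A → Set} {OkA : A → Program → Set}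
  {B : Set} {getB : B → ℕ → ℕ} {setB : B → ℕ → ℕ → B} {_≈B_ : B → B → Set} {OkB : B → Program → Set}
  where

  private
    module EA = Eval A getA setA _≈A_ OkA
    module EB = Eval B getB setB _≈B_ OkB

  record Simulation (U : Program) : Set₁ where
    field
      _~_   : A → B → Set
      ok    : ∀ {a b} → a ~ b → OkA a U → OkB b U
      reads : ∀ {a b h i j k} → a ~ b → OkA a U → instrAt U h ≡ just (J i j k) →
              getA a (idx i) ≡ getB b (idx i) × getA a (idx j) ≡ getB b (idx j)
      step  : ∀ {a a' b h I} → a ~ b → OkA a U → instrAt U h ≡ just I → EA.Op I a a' →
              Σ B λ b' → EB.Op I b b' × a' ~ b'
      -- c and d are the final configurations of the source and target runs.
      halt  : ∀ {a b c d} → a ~ b → c ~ d → c ≈A a → d ≈B b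

  module _ {U : Program} (S : Simulation U) where
    open Simulation S

    private
      test-≡ : ∀ {a b h i j k} → a ~ b → OkA a U → instrAt U h ≡ just (J i j k) →
               getA a (idx i) ≡ getA a (idx j) → getB b (idx i) ≡ getB b (idx j)
      test-≡ r o e = let (ei , ej) = reads r o e in subst₂ _≡_ ei ej

      test-≢ : ∀ {a b h i j k} → a ~ b → OkA a U → instrAt U h ≡ just (J i j k) →
               getA a (idx i) ≢ getA a (idx j) → getB b (idx i) ≢ getB b (idx j)
      test-≢ r o e ne = let (ei , ej) = reads r o e in λ eq → ne (subst₂ _≡_ (sym ei) (sym ej) eq)

    cp₊-transfer : ∀ {a b h c d} → a ~ b → c ~ d → EA.cp₊ U a h c → EB.cp₊ U b h d
    cp₊-transfer r rc (EA.j-last o e hl ne eq) =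
      EB.j-last (ok r o) e hl (test-≢ r o e ne) (halt r rc eq)
    cp₊-transfer r rc (EA.j-next o e hl ne c) =
      EB.j-next (ok r o) e hl (test-≢ r o e ne) (cp₊-transfer r rc c)
    cp₊-transfer r rc (EA.j-halt o e k0 eq eqc) =
      EB.j-halt (ok r o) e k0 (test-≡ r o e eq) (halt r rc eqc)
    cp₊-transfer r rc (EA.j-jump o e k0 eq c) =
      EB.j-jump (ok r o) e k0 (test-≡ r o e eq) (cp₊-transfer r rc c)
    cp₊-transfer r rc (EA.op-last o e op hl eq) =
      let (_ , op' , r') = step r o e op in EB.op-last (ok r o) e op' hl (halt r' rc eq)
    cp₊-transfer r rc (EA.op-next o e op hl c) =
      let (_ , op' , r') = step r o e op in EB.op-next (ok r o) e op' hl (cp₊-transfer r' rc c)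

    cp∞-transfer : ∀ {a b h} → a ~ b → EA.cp∞ U a h → EB.cp∞ U b h
    cp∞-transfer {a} r (P , p , closed) = Q , (a , p , r) , closed'
      where
      Q : B → ℕ → Set
      Q b h = Σ A λ a → P a h × a ~ b

      closed' : ∀ b h → Q b h → EB.Step∞ U Q b h
      closed' b h (a , p , r) with closed a h p
      ... | EA.j-next o e hl ne p' = EB.j-next (ok r o) e hl (test-≢ r o e ne) (a , p' , r)
      ... | EA.j-jump o e k0 eq p' = EB.j-jump (ok r o) e k0 (test-≡ r o e eq) (a , p' , r)
      ... | EA.op-next o e op hl p' =
        let (_ , op' , r') = step r o e op in
        EB.op-next (ok r o) e op' hl (_ , p' , r')

open Transfer

inclusion : ∀ U → Simulation {OkA = _⊨_} {OkB = λ _ _ → ⊤} U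
inclusion U = record
  { _~_   = _⊂_
  ; ok    = λ _ _ → tt
  ; reads = λ { {σ} {σ∞} {i = i} {j} sub (_ , bounded) e →
                let (ri , rj) = All.lookup bounded (instrAt⇒∈ U e) in
                ⊂-getF {σ} {σ∞} sub (pos i) ri , ⊂-getF {σ} {σ∞} sub (pos j) rj }
  ; step  = λ { {σ} {b = σ∞} sub (_ , bounded) e →
                ⊂-Op {σ = σ} {σ∞ = σ∞} sub (All.lookup bounded (instrAt⇒∈ U e)) }
  ; halt  = λ { {σ} sub sub' refl → ⊂-unique {σ} sub' sub }
  }

restriction : ∀ U → StandardForm U → Simulation {OkA = λ _ _ → ⊤} {OkB = _⊨_} U
restriction U sf = record
  { _~_   = λ τ σ → σ ≡ restrict τ U
  ; ok    = λ { {τ} refl _ → restrict-⊨ τ sf }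
  ; reads = λ { {τ} {i = i} {j} refl _ e →
                let (ri , rj) = All.lookup (All-RegsBounded-ρ U) (instrAt⇒∈ U e) in
                sym (getF-prefix (ρ U) τ (pos i) ri) , sym (getF-prefix (ρ U) τ (pos j) rj) }
  ; step  = λ { refl _ e → prefix-Op (All.lookup (All-RegsBounded-ρ U) (instrAt⇒∈ U e)) }
  ; halt  = λ { refl refl eq → prefix-cong (ρ U) eq }
  }

mainTheorem1 : (U : Program) (σ τ : Config) (σ∞ τ∞ : Config∞) (h : ℕ) →
    1 ≤ h → h ≤ length U →
    (cp₊F U σ h τ → σ ⊨ U → σ ⊂ σ∞ → τ ⊂ τ∞ → cp₊∞ U σ∞ h τ∞)
    × (cp∞F U σ h → σ ⊨ U → σ ⊂ σ∞ → cp∞∞ U σ∞ h)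
    × (StandardForm U → cp₊∞ U σ∞ h τ∞ → cp₊F U (restrict σ∞ U) h (restrict τ∞ U))
    × (StandardForm U → cp∞∞ U σ∞ h → cp∞F U (restrict σ∞ U) h)
mainTheorem1 U σ τ σ∞ τ∞ h _ _ =
    (λ c _ sub sub′ → cp₊-transfer (inclusion U) sub sub′ c)
  , (λ c _ sub → cp∞-transfer (inclusion U) sub c)
  , (λ sf c → cp₊-transfer (restriction U sf) refl refl c)
  , (λ sf c → cp∞-transfer (restriction U sf) refl c)
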